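{- Let $\mathcal{M}=(E,\mathcal{C})$ be a loopless oriented matroid with ground set $E=\{e_1,\dots,e_m\}$ totally ordered by $e_1\prec e_2\prec\cdots\prec e_m$, and for $0\le k\le m$ let $E_k=\{e_1,\dots,e_k\}$. For $N\subseteq E_k$ write $N^c=E_k-N$. Let $\mathscr{N}_k$ be the set of pairs $(N_k,A_k)$ with $N_k\subseteq E_k$, $A_k\subseteq E-E_k$, such that $N_k$ is an NBC subset of the underlying matroid $\underline{\mathcal{M}}$ and $\mathcal{M}_k:={}_{ -A_k}(\mathcal{M}\backslash N_k^c/N_k)$ is acyclic. For $1\le k\le m$ and $(N_{k-1},A_{k-1})\in\mathscr{N}_{k-1}$, with $\mathcal{M}_{k-1}={}_{ -A_{k-1}}(\mathcal{M}\backslash N_{k-1}^c/N_{k-1})$ (an oriented matroid on $E-E_{k-1}\ni e_k$), define $$\psi_k(N_{k-1},A_{k-1})=\begin{cases}(N_{k-1}\cup\{e_k\},A_{k-1}) & \text{if } e_k\notin A_{k-1}\text{ and } {}_{ -\{e_k\}}\mathcal{M}_{k-1}\text{ is acyclic};\\ (N_{k-1},A_{k-1}) & \text{if } e_k\notin A_{k-1}\text{ and } {}_{ -\{e_k\}}\mathcal{M}_{k-1}\text{ is not acyclic};\\ (N_{k-1},A_{k-1}-\{e_k\}) & \text{if } e_k\in A_{k-1}.\end{cases}$$ Then $\psi_k$ is well-defined as a map $\mathscr{N}_{k-1}\to\mathscr{N}_k$, i.e. $\psi_k(N_{k-1},A_{k-1})\in\mathscr{N}_k$ for every $(N_{k-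1},A_{k-1})\in\mathscr{N}_{k-1}$.
   Context: Signed circuits $X=(X^+,X^-)$, support $\underline{X}=X^+\cup X^-$; positive circuit: $X^-=\emptyset$; acyclic: no positive circuits. The underlying matroid $\underline{\mathcal{M}}$ has circuits $\{\underline{X}:X\in\mathcal{C}\}$; loopless means no circuit of size one. A broken circuit of $\underline{\mathcal{M}}$ is a circuit with its $\prec$-maximal element removed; an NBC subset is a subset of $E$ containing no broken circuit. For $A\subseteq E$, the reorientation ${}_{ -A}\mathcal{M}$ has signed circuits ${}_{ -A}X=((X^+-A)\cup(X^-\cap A),(X^--A)\cup(X^+\cap A))$ for $X\in\mathcal{C}$. Deletion $\mathcal{M}\backslash S$ has signed circuits $\{Y\in\mathcal{C}:\underline{Y}\subseteq E-S\}$; contraction $\mathcal{M}/S$ has as signed circuits the support-minimal nonempty members of $\{(Y^+-S,Y^--S):Y\in\mathcal{C},\ \underline{Y}-S\ne\emptyset\}$; deletion and contraction of disjoint sets commute. Reorientation by a set is applied to the minor (on its ground set). -}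

module Defs where

open import Data.Bool using (Bool; true; false; if_then_else_)
open import Data.Nat using (ℕ; suc; _≤_; _<ᵇ_)
open import Data.Fin using (Fin; toℕ)
open import Data.Fin.Subset using (Subset; inside; outside; ⊥; ⁅_⁆; _∈_; _⊆_; ∁; _∩_; _∪_; _─_; _-_; ∣_∣)
open import Data.Vec using (tabulate; lookup)
open import Data.Product using (Σ; _×_; _,_; ∃; proj₁; proj₂)
open import Data.Sum using (_⊎_)
open import Relation.Binary.PropositionalEquality using (_≡_; _≢_)
open import Relation.Nullary using (¬_; Dec; yes; no)
import Data.Empty as E

-- Ground set E = Fin m, with e_{i+1} = i and the order ≺ the usual order on Fin m.

record SignedSet (m : ℕ) : Set where
  constructor ⟨_,_⟩
  field
    pos : Subset m
    neg : Subset m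
open SignedSet public

support : ∀ {m} → SignedSet m → Subset m
support X = pos X ∪ neg X

opp : ∀ {m} → SignedSet m → SignedSet m
opp X = ⟨ neg X , pos X ⟩

reorientSS : ∀ {m} → Subset m → SignedSet m → SignedSet m
reorientSS A X = ⟨ (pos X ─ A) ∪ (neg X ∩ A) , (neg X ─ A) ∪ (pos X ∩ A) ⟩

Family : ℕ → Set₁
Family m = SignedSet m → Set

record OrientedMatroid (m : ℕ) : Set₁ where
  field
    𝒞 : Family m
    signed   : ∀ X → 𝒞 X → pos X ∩ neg X ≡ ⊥
    C0       : ∀ X → 𝒞 X → support X ≢ ⊥
    C1       : ∀ X → 𝒞 X → 𝒞 (opp X)
    C2       : ∀ X Y → 𝒞 X → 𝒞 Y → support X ⊆ support Y → (X ≡ Y) ⊎ (X ≡ opp Y)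
    C3       : ∀ X Y e → 𝒞 X → 𝒞 Y → X ≢ opp Y → e ∈ pos X → e ∈ neg Y →
               Σ (SignedSet m) λ Z → 𝒞 Z × (pos Z ⊆ (pos X ∪ pos Y) - e)
                                         × (neg Z ⊆ (neg X ∪ neg Y) - e)
open OrientedMatroid public

Loopless : ∀ {m} → OrientedMatroid m → Set
Loopless M = ∀ X → 𝒞 M X → ¬ (∣ support X ∣ ≡ 1)

-- Operations on the circuit families (minors keep the ambient E = Fin m;
-- their circuits have supports inside the minor's ground set)

Positive : ∀ {m} → SignedSet m → Set
Positive X = neg X ≡ ⊥

Acyclic : ∀ {m} → Family m → Set
Acyclic C = ∀ X → C X → ¬ Positive X

Reorient : ∀ {m} → Subset m → Family m → Family m
Reorient A C Z = Σ _ λ X → C X × (Z ≡ reorientSS A X)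

Delete : ∀ {m} → Family m → Subset m → Family m
Delete C S Y = C Y × (support Y ⊆ ∁ S)

ContrCand : ∀ {m} → Family m → Subset m → Family m
ContrCand C S Z = Σ _ λ Y → C Y × (support Y ─ S ≢ ⊥) × (Z ≡ ⟨ pos Y ─ S , neg Y ─ S ⟩)

Contract : ∀ {m} → Family m → Subset m → Family m
Contract C S Z = ContrCand C S Z × (∀ W → ContrCand C S W → support W ⊆ support Z → support Z ⊆ support W)

BrokenCircuit : ∀ {m} → OrientedMatroid m → Subset m → Set
BrokenCircuit M B = Σ _ λ X → 𝒞 M X × Σ _ λ e → e ∈ support X
                     × (∀ f → f ∈ support X → toℕ f ≤ toℕ e) × (B ≡ support X - e)

NBC : ∀ {m} → OrientedMatroid m → Subset m → Set
NBC M N = ∀ B → BrokenCircuit M B → ¬ (B ⊆ N)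

Ek : ∀ {m} → ℕ → Subset m
Ek k = tabulate λ i → if toℕ i <ᵇ k then inside else outside

Mk : ∀ {m} → OrientedMatroid m → ℕ → Subset m → Subset m → Family m
Mk M k N A = Reorient A (Contract (Delete (𝒞 M) (Ek k ─ N)) N)

InN : ∀ {m} → OrientedMatroid m → ℕ → Subset m × Subset m → Set
InN M k (N , A) = (N ⊆ Ek k) × (A ⊆ ∁ (Ek k)) × NBC M N × Acyclic (Mk M k N A)

-- ψ_k for k = toℕ j + 1 (so e_k = j).  The case split on whether
-- _{-{e_k}} M_{k-1} is acyclic is given by an (arbitrary) decision of that proposition.
ψ : ∀ {m} (M : OrientedMatroid m) (j : Fin m) (N A : Subset m) →
    Dec (Acyclic (Reorient ⁅ j ⁆ (Mk M (toℕ j) N A))) → Subset m × Subset m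
ψ M j N A d with lookup A j
... | true = N , A - j
... | false with d
...   | yes _ = N ∪ ⁅ j ⁆ , A
...   | no _  = N , A

module Submission where

-- Let M′ = ₋A(M \ N^c / N) be the acyclic minor of (N, A).  If e_k ∈ A, or e_k is deleted,
-- the new minor is a deletion of M′ (up to reorienting e_k, which no longer occurs), so it
-- stays acyclic.  If e_k is contracted, M′ and ₋{e_k}M′ are both acyclic.  Every circuit Z
-- of M′ / e_k extends to a circuit V of M′ conforming to Z off e_k: descend from any preimage
-- along strictly smaller supports; a sign change would let circuit elimination produce a
-- circuit inside Z, contradicting its minimality.  Whatever sign e_k has in V, V is positive
-- in M′ or in ₋{e_k}M′.  Finally N ∪ {e_k} is still NBC because e_k exceeds every element of
-- N: a broken circuit through e_k would leave a loop in the new minor, and an acyclic minor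
-- has no loops since one of the two orientations of a loop is positive.

open import Defs
open import Data.Bool using (true; false; if_then_else_)
open import Data.Bool.Properties using (T-≡)
open import Data.Nat using (ℕ; suc; _<_; _≤_; _<ᵇ_; z≤n; s≤s)
open import Data.Nat.Properties using (<ᵇ⇒<; <⇒<ᵇ; <-irrefl; <⇒≱; ≤∧≢⇒<; m<n⇒m<1+n; ≤-pred; ≤-refl; <⇒≤)
open import Data.Nat.Induction using (<-wellFounded)
open import Induction.WellFounded using (Acc; acc)
open import Data.Fin using (Fin; toℕ; zero; suc)
open import Data.Fin.Properties using (toℕ-injective) renaming (_≟_ to _≟ᶠ_)
open import Data.Fin.Subset renaming (⊥ to ∅)
open import Data.Fin.Subset.Properties
open import Data.Vec using (_∷_; lookup; here; there)
open import Data.Vec.Properties using ([]=⇒lookup; lookup⇒[]=; lookup∘tabulate)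
open import Data.Product using (∃; _×_; _,_; proj₁; proj₂)
open import Data.Sum using (_⊎_; inj₁; inj₂; [_,_]′; swap) renaming (map to map-⊎)
open import Data.Empty using (⊥; ⊥-elim)
open import Function using (_∘_; case_of_; Equivalence)
open import Relation.Binary.PropositionalEquality using (_≡_; _≢_; refl; sym; trans; subst; cong₂)
open import Relation.Nullary using (¬_; Dec; yes; no)

private variable
  m k : ℕ
  x y e f g j : Fin m
  p q A B N S T : Subset m
  X Y Z V W : SignedSet m
  C : Family m

p≡∅⇒x∉p : p ≡ ∅ → x ∉ p
p≡∅⇒x∉p refl = ∉⊥

x∈p─q⇒x∉q : ∀ (p q : Subset m) → x ∈ p ─ q → x ∉ q
x∈p─q⇒x∉q (_ ∷ p) (_ ∷ q) (there x∈p─q) (there x∈q) = x∈p─q⇒x∉q p q x∈p─q x∈q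

x∈p─q⁻ : x ∈ p ─ q → x ∈ p × x ∉ q
x∈p─q⁻ {p = p} {q} x∈ = p─q⊆p p q x∈ , x∈p─q⇒x∉q p q x∈

x∈p-y⁻ : x ∈ p - y → x ∈ p × x ≢ y
x∈p-y⁻ x∈ = let x∈p , x∉y = x∈p─q⁻ x∈ in x∈p , x∉⁅y⁆⇒x≢y x∉y

x∈p∪⁅y⁆⁻ : x ∈ p ∪ ⁅ y ⁆ → x ∈ p ⊎ x ≡ y
x∈p∪⁅y⁆⁻ {p = p} {y} x∈ with x∈p∪q⁻ p ⁅ y ⁆ x∈
... | inj₁ x∈p = inj₁ x∈p
... | inj₂ x∈y = inj₂ (x∈⁅y⁆⇒x≡y y x∈y)

y∈p∪⁅y⁆ : ∀ (p : Subset m) y → y ∈ p ∪ ⁅ y ⁆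
y∈p∪⁅y⁆ p y = x∈p∪q⁺ (inj₂ (x∈⁅x⁆ y))

x∉p∪⁅y⁆ : x ∉ p → x ≢ y → x ∉ p ∪ ⁅ y ⁆
x∉p∪⁅y⁆ x∉p x≢y x∈ = [ x∉p , x≢y ]′ (x∈p∪⁅y⁆⁻ x∈)

⊈⇒∃∉ : p ⊈ q → ∃ λ x → x ∈ p × x ∉ q
⊈⇒∃∉ {p = p} {q} p⊈q with nonempty? (p ─ q)
... | yes (x , x∈) = x , x∈p─q⁻ x∈
... | no empty = ⊥-elim (p⊈q p⊆q)
  where
  p⊆q : p ⊆ q
  p⊆q {x} x∈p with x ∈? q
  ... | yes x∈q = x∈q
  ... | no x∉q = ⊥-elim (empty (x , x∈p∧x∉q⇒x∈p─q x∈p x∉q))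

⊈⇒─≢∅ : p ⊈ q → p ─ q ≢ ∅
⊈⇒─≢∅ p⊈q p─q≡∅ = let x , x∈p , x∉q = ⊈⇒∃∉ p⊈q in p≡∅⇒x∉p p─q≡∅ (x∈p∧x∉q⇒x∈p─q x∈p x∉q)

≢∅⇒Nonempty : p ≢ ∅ → Nonempty p
≢∅⇒Nonempty {p = p} p≢∅ with nonempty? p
... | yes ne = ne
... | no empty = ⊥-elim (p≢∅ (Empty-unique empty))

lookup≡false⇒∉ : lookup p x ≡ false → x ∉ p
lookup≡false⇒∉ p[x]≡false x∈p = case trans (sym ([]=⇒lookup x∈p)) p[x]≡false of λ ()

max-element : ∀ (p : Subset m) → Nonempty p → ∃ λ e → e ∈ p × (∀ f → f ∈ p → toℕ f ≤ toℕ e)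
max-element (s ∷ p) ne with nonempty? p
... | yes ne′ = let e , e∈p , max = max-element p ne′ in
  suc e , there e∈p , λ { zero _ → z≤n ; (suc f) (there f∈p) → s≤s (max f f∈p) }
max-element (true ∷ p) ne | no empty =
  zero , here , λ { zero _ → z≤n ; (suc f) (there f∈p) → ⊥-elim (empty (f , f∈p)) }
max-element (false ∷ p) (suc f , there f∈p) | no empty = ⊥-elim (empty (f , f∈p))

lookup-Ek : lookup (Ek k) x ≡ (toℕ x <ᵇ k)
lookup-Ek {k = k} {x = x} = trans (lookup∘tabulate _ x) (if-true-false (toℕ x <ᵇ k))
  where
  if-true-false : ∀ b → (if b then true else false) ≡ b
  if-true-false true = refl
  if-true-false false = refl

∈Ek⇒toℕ< : x ∈ Ek k → toℕ x < k
∈Ek⇒toℕ< {x = x} {k} x∈ = <ᵇ⇒< _ _ (Equivalence.from T-≡ (trans (sym (lookup-Ek {k = k} {x = x})) ([]=⇒lookup x∈)))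

toℕ<⇒∈Ek : toℕ x < k → x ∈ Ek k
toℕ<⇒∈Ek {x = x} {k} x<k = lookup⇒[]= x _ (trans (lookup-Ek {k = k} {x = x}) (Equivalence.to T-≡ (<⇒<ᵇ x<k)))

Ek⊆Ek-suc : Ek k ⊆ Ek {m} (suc k)
Ek⊆Ek-suc = toℕ<⇒∈Ek ∘ m<n⇒m<1+n ∘ ∈Ek⇒toℕ<

j∈Ek-suc : j ∈ Ek (suc (toℕ j))
j∈Ek-suc = toℕ<⇒∈Ek (s≤s ≤-refl)

j∉Ek : j ∉ Ek (toℕ j)
j∉Ek j∈ = <-irrefl refl (∈Ek⇒toℕ< j∈)

∈Ek-suc⁻ : x ∈ Ek (suc (toℕ j)) → x ∈ Ek (toℕ j) ⊎ x ≡ j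
∈Ek-suc⁻ {x = x} {j = j} x∈ with x ≟ᶠ j
... | yes x≡j = inj₂ x≡j
... | no x≢j = inj₁ (toℕ<⇒∈Ek (≤∧≢⇒< (≤-pred (∈Ek⇒toℕ< x∈)) (x≢j ∘ toℕ-injective)))

∁Ek-suc : A ⊆ ∁ (Ek (toℕ j)) → j ∉ A → A ⊆ ∁ (Ek (suc (toℕ j)))
∁Ek-suc A⊆∁Ek j∉A {x} x∈A = x∉p⇒x∈∁p λ x∈Ek-suc → case ∈Ek-suc⁻ x∈Ek-suc of λ where
  (inj₁ x∈Ek) → x∈∁p⇒x∉p (A⊆∁Ek x∈A) x∈Ek
  (inj₂ refl) → j∉A x∈A

Ek-suc─∪ : Ek (suc (toℕ j)) ─ (N ∪ ⁅ j ⁆) ≡ Ek (toℕ j) ─ N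
Ek-suc─∪ {j = j} {N = N} = ⊆-antisym shrink grow
  where
  shrink : Ek (suc (toℕ j)) ─ (N ∪ ⁅ j ⁆) ⊆ Ek (toℕ j) ─ N
  shrink x∈ with x∈p─q⁻ x∈
  ... | x∈Ek-suc , x∉N∪j with ∈Ek-suc⁻ x∈Ek-suc
  ...   | inj₁ x∈Ek = x∈p∧x∉q⇒x∈p─q x∈Ek (x∉N∪j ∘ x∈p∪q⁺ ∘ inj₁)
  ...   | inj₂ refl = ⊥-elim (x∉N∪j (y∈p∪⁅y⁆ N j))
  grow : Ek (toℕ j) ─ N ⊆ Ek (suc (toℕ j)) ─ (N ∪ ⁅ j ⁆)
  grow x∈ with x∈p─q⁻ x∈
  ... | x∈Ek , x∉N = x∈p∧x∉q⇒x∈p─q (Ek⊆Ek-suc x∈Ek) (x∉p∪⁅y⁆ x∉N λ { refl → j∉Ek x∈Ek })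

infixl 5 _⊖_
_⊖_ : SignedSet m → Subset m → SignedSet m
X ⊖ S = ⟨ pos X ─ S , neg X ─ S ⟩

infix 4 _≼_
_≼_ : SignedSet m → SignedSet m → Set
X ≼ Y = pos X ⊆ pos Y × neg X ⊆ neg Y

≼-refl : X ≼ X
≼-refl = (λ f∈ → f∈) , (λ f∈ → f∈)

≼⇒support⊆ : X ≼ Y → support X ⊆ support Y
≼⇒support⊆ {X = X} (pos⊆ , neg⊆) f∈ with x∈p∪q⁻ (pos X) (neg X) f∈
... | inj₁ f∈pos = x∈p∪q⁺ (inj₁ (pos⊆ f∈pos))
... | inj₂ f∈neg = x∈p∪q⁺ (inj₂ (neg⊆ f∈neg))

support-⊖⁻ : f ∈ support (X ⊖ S) → f ∈ support X × f ∉ S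
support-⊖⁻ {X = X} {S} f∈ with x∈p∪q⁻ (pos X ─ S) (neg X ─ S) f∈
... | inj₁ f∈pos = let f∈ , f∉S = x∈p─q⁻ f∈pos in x∈p∪q⁺ (inj₁ f∈) , f∉S
... | inj₂ f∈neg = let f∈ , f∉S = x∈p─q⁻ f∈neg in x∈p∪q⁺ (inj₂ f∈) , f∉S

support-⊖⁺ : f ∈ support X → f ∉ S → f ∈ support (X ⊖ S)
support-⊖⁺ {X = X} f∈ f∉S with x∈p∪q⁻ (pos X) (neg X) f∈
... | inj₁ f∈pos = x∈p∪q⁺ (inj₁ (x∈p∧x∉q⇒x∈p─q f∈pos f∉S))
... | inj₂ f∈neg = x∈p∪q⁺ (inj₂ (x∈p∧x∉q⇒x∈p─q f∈neg f∉S))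

support-opp : support (opp X) ⊆ support X
support-opp {X = X} f∈ = x∈p∪q⁺ (swap (x∈p∪q⁻ (neg X) (pos X) f∈))

⊖-⊖ : X ⊖ p ⊖ q ≡ X ⊖ (p ∪ q)
⊖-⊖ {X = X} {p} {q} = cong₂ ⟨_,_⟩ (p─q─r≡p─q∪r (pos X) p q) (p─q─r≡p─q∪r (neg X) p q)

support-⊖-mono : support X ⊆ support Y → support (X ⊖ S) ⊆ support (Y ⊖ S)
support-⊖-mono X⊆Y f∈ = let f∈X , f∉S = support-⊖⁻ f∈ in support-⊖⁺ (X⊆Y f∈X) f∉S

Positive-reorientSS⁺ : neg X ⊆ A → pos X ⊆ ∁ A → Positive (reorientSS A X)
Positive-reorientSS⁺ {X = X} {A} neg⊆A pos⊆∁A = Empty-unique λ (f , f∈) →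
  case x∈p∪q⁻ (neg X ─ A) (pos X ∩ A) f∈ of λ where
    (inj₁ f∈neg─A) → let f∈neg , f∉A = x∈p─q⁻ f∈neg─A in f∉A (neg⊆A f∈neg)
    (inj₂ f∈pos∩A) → let f∈pos , f∈A = x∈p∩q⁻ (pos X) A f∈pos∩A in x∈∁p⇒x∉p (pos⊆∁A f∈pos) f∈A

Positive-reorientSS⁻ : Positive (reorientSS A X) → neg X ⊆ A × pos X ⊆ ∁ A
Positive-reorientSS⁻ {A = A} {X} positive = neg⊆A , pos⊆∁A
  where
  neg⊆A : neg X ⊆ A
  neg⊆A {f} f∈neg with f ∈? A
  ... | yes f∈A = f∈A
  ... | no f∉A = ⊥-elim (p≡∅⇒x∉p positive (x∈p∪q⁺ (inj₁ (x∈p∧x∉q⇒x∈p─q f∈neg f∉A))))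
  pos⊆∁A : pos X ⊆ ∁ A
  pos⊆∁A f∈pos = x∉p⇒x∈∁p λ f∈A → p≡∅⇒x∉p positive (x∈p∪q⁺ (inj₂ (x∈p∩q⁺ (f∈pos , f∈A))))

Positive-reorientSS-cong : (∀ {f} → f ∈ support X → f ∈ A → f ∈ B) → (∀ {f} → f ∈ support X → f ∈ B → f ∈ A) →
                           Positive (reorientSS A X) → Positive (reorientSS B X)
Positive-reorientSS-cong A⇒B B⇒A positive with Positive-reorientSS⁻ positive
... | neg⊆A , pos⊆∁A = Positive-reorientSS⁺
  (λ f∈neg → A⇒B (x∈p∪q⁺ (inj₂ f∈neg)) (neg⊆A f∈neg))
  (λ f∈pos → x∉p⇒x∈∁p λ f∈B → x∈∁p⇒x∉p (pos⊆∁A f∈pos) (B⇒A (x∈p∪q⁺ (inj₁ f∈pos)) f∈B))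

Positive-reorientSS-twice : (∀ {f} → f ∈ A → f ∉ B) → Positive (reorientSS (A ∪ B) X) →
                            Positive (reorientSS B (reorientSS A X))
Positive-reorientSS-twice {A = A} {B} {X} disjoint positive with Positive-reorientSS⁻ positive
... | neg⊆A∪B , pos⊆∁A∪B = Positive-reorientSS⁺ neg⊆B pos⊆∁B
  where
  neg⊆B : neg (reorientSS A X) ⊆ B
  neg⊆B f∈ with x∈p∪q⁻ (neg X ─ A) (pos X ∩ A) f∈
  ... | inj₁ f∈neg─A = let f∈neg , f∉A = x∈p─q⁻ f∈neg─A in
    [ ⊥-elim ∘ f∉A , (λ f∈B → f∈B) ]′ (x∈p∪q⁻ A B (neg⊆A∪B f∈neg))
  ... | inj₂ f∈pos∩A = let f∈pos , f∈A = x∈p∩q⁻ (pos X) A f∈pos∩A in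
    ⊥-elim (x∈∁p⇒x∉p (pos⊆∁A∪B f∈pos) (x∈p∪q⁺ (inj₁ f∈A)))
  pos⊆∁B : pos (reorientSS A X) ⊆ ∁ B
  pos⊆∁B f∈ = x∉p⇒x∈∁p λ f∈B → case x∈p∪q⁻ (pos X ─ A) (neg X ∩ A) f∈ of λ where
    (inj₁ f∈pos─A) → x∈∁p⇒x∉p (pos⊆∁A∪B (proj₁ (x∈p─q⁻ f∈pos─A))) (x∈p∪q⁺ (inj₂ f∈B))
    (inj₂ f∈neg∩A) → disjoint (proj₂ (x∈p∩q⁻ (neg X) A f∈neg∩A)) f∈B

Positive-reorientSS-extend : X ⊖ ⁅ e ⁆ ≼ Y → (e ∈ pos X → e ∉ neg X) → e ∉ A → Positive (reorientSS A Y) →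
                             Positive (reorientSS A X) ⊎ Positive (reorientSS ⁅ e ⁆ (reorientSS A X))
Positive-reorientSS-extend {X = X} {e} {Y} {A} (pos-conf , neg-conf) signed e∉A Y-positive
  with Positive-reorientSS⁻ Y-positive | e ∈? neg X
... | negY⊆A , posY⊆∁A | no e∉neg = inj₁ (Positive-reorientSS⁺ neg⊆A pos⊆∁A)
  where
  neg⊆A : neg X ⊆ A
  neg⊆A f∈neg = negY⊆A (neg-conf (x∈p∧x≢y⇒x∈p-y f∈neg λ { refl → e∉neg f∈neg }))
  pos⊆∁A : pos X ⊆ ∁ A
  pos⊆∁A {f} f∈pos with f ≟ᶠ e
  ... | yes refl = x∉p⇒x∈∁p e∉A
  ... | no f≢e = posY⊆∁A (pos-conf (x∈p∧x≢y⇒x∈p-y f∈pos f≢e))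
... | negY⊆A , posY⊆∁A | yes e∈neg = inj₂ (Positive-reorientSS-twice disjoint (Positive-reorientSS⁺ neg⊆A∪e pos⊆∁A∪e))
  where
  disjoint : ∀ {f} → f ∈ A → f ∉ ⁅ e ⁆
  disjoint f∈A f∈e = e∉A (subst (_∈ A) (x∈⁅y⁆⇒x≡y e f∈e) f∈A)
  neg⊆A∪e : neg X ⊆ A ∪ ⁅ e ⁆
  neg⊆A∪e {f} f∈neg with f ≟ᶠ e
  ... | yes refl = y∈p∪⁅y⁆ A e
  ... | no f≢e = x∈p∪q⁺ (inj₁ (negY⊆A (neg-conf (x∈p∧x≢y⇒x∈p-y f∈neg f≢e))))
  pos⊆∁A∪e : pos X ⊆ ∁ (A ∪ ⁅ e ⁆)
  pos⊆∁A∪e {f} f∈pos = x∉p⇒x∈∁p (x∉p∪⁅y⁆ (x∈∁p⇒x∉p (posY⊆∁A (pos-conf (x∈p∧x≢y⇒x∈p-y f∈pos f≢e)))) f≢e)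
    where
    f≢e : f ≢ e
    f≢e refl = signed f∈pos e∈neg

Positive-reorientSS-loop : (∀ {f} → f ∈ support X → f ≡ e) → (e ∈ neg X → e ∈ A) → (e ∈ pos X → e ∉ A) →
                           Positive (reorientSS A X)
Positive-reorientSS-loop {X = X} only-e neg⇒A pos⇒∉A = Positive-reorientSS⁺
  (λ f∈neg → case only-e (x∈p∪q⁺ (inj₂ f∈neg)) of λ { refl → neg⇒A f∈neg })
  (λ f∈pos → case only-e (x∈p∪q⁺ (inj₁ f∈pos)) of λ { refl → x∉p⇒x∈∁p (pos⇒∉A f∈pos) })

Positive-loop : (∀ {f} → f ∈ support X → f ≡ e) → (e ∈ pos X → e ∉ neg X) →
                Positive (reorientSS A X) ⊎ Positive (reorientSS A (opp X))
Positive-loop {X = X} {e} {A} only-e signed with e ∈? A | e ∈? pos X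
... | yes e∈A | yes e∈pos = inj₂ (Positive-reorientSS-loop (only-e ∘ support-opp) (λ _ → e∈A) (⊥-elim ∘ signed e∈pos))
... | yes e∈A | no e∉pos  = inj₁ (Positive-reorientSS-loop only-e (λ _ → e∈A) (⊥-elim ∘ e∉pos))
... | no e∉A  | yes e∈pos = inj₁ (Positive-reorientSS-loop only-e (⊥-elim ∘ signed e∈pos) (λ _ → e∉A))
... | no e∉A  | no e∉pos  = inj₂ (Positive-reorientSS-loop (only-e ∘ support-opp) (⊥-elim ∘ e∉pos) (λ _ → e∉A))

candidate : C Y → support Y ⊈ T → ContrCand C T (Y ⊖ T)
candidate cY Y⊈T = _ , cY , ⊈⇒─≢∅ Y⊈T , refl

candidate-nonempty : ContrCand C T Z → Nonempty (support Z)
candidate-nonempty (Y , _ , Y─T≢∅ , refl) =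
  let f , f∈ = ≢∅⇒Nonempty Y─T≢∅ ; f∈Y , f∉T = x∈p─q⁻ f∈ in f , support-⊖⁺ f∈Y f∉T

candidate-signed : ∀ {M : OrientedMatroid m} → ContrCand (Delete (𝒞 M) S) T Z → f ∈ pos Z → f ∉ neg Z
candidate-signed {M = M} (Y , (cY , _) , _ , refl) f∈pos f∈neg =
  p≡∅⇒x∉p (signed M Y cY) (x∈p∩q⁺ (proj₁ (x∈p─q⁻ f∈pos) , proj₁ (x∈p─q⁻ f∈neg)))

candidate-avoids : ContrCand (Delete C S) T Z → f ∈ support Z → f ∉ S
candidate-avoids (Y , (_ , Y⊆∁S) , _ , refl) f∈ = x∈∁p⇒x∉p (Y⊆∁S (proj₁ (support-⊖⁻ f∈)))

contract-delete-mono : S ⊆ T → Contract (Delete C (T ─ N)) N Z → Contract (Delete C (S ─ N)) N Z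
contract-delete-mono {S = S} {T} {N = N} S⊆T ((Y , (cY , Y⊆) , ne , refl) , minimal) =
  (Y , (cY , λ f∈ → p⊆q⇒∁p⊇∁q S─N⊆T─N (Y⊆ f∈)) , ne , refl) ,
  λ { W (Y′ , (cY′ , _) , ne′ , refl) W⊆Z → minimal W (Y′ , (cY′ , avoids Y′ W⊆Z) , ne′ , refl) W⊆Z }
  where
  S─N⊆T─N : S ─ N ⊆ T ─ N
  S─N⊆T─N f∈ = let f∈S , f∉N = x∈p─q⁻ f∈ in x∈p∧x∉q⇒x∈p─q (S⊆T f∈S) f∉N
  avoids : ∀ Y′ → support (Y′ ⊖ N) ⊆ support (Y ⊖ N) → support Y′ ⊆ ∁ (T ─ N)
  avoids Y′ sub f∈ = x∉p⇒x∈∁p λ f∈T─N →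
    x∈∁p⇒x∉p (Y⊆ (proj₁ (support-⊖⁻ (sub (support-⊖⁺ f∈ (proj₂ (x∈p─q⁻ f∈T─N))))))) f∈T─N

acyclic-delete : S ⊆ T → (∀ {f} → f ∉ T ─ N → f ∈ A → f ∈ B) → (∀ {f} → f ∉ T ─ N → f ∈ B → f ∈ A) →
                 Acyclic (Reorient A (Contract (Delete C (S ─ N)) N)) →
                 Acyclic (Reorient B (Contract (Delete C (T ─ N)) N))
acyclic-delete S⊆T A⇒B B⇒A acyclic _ (Z , Z-circuit , refl) positive =
  acyclic _ (Z , contract-delete-mono S⊆T Z-circuit , refl)
    (Positive-reorientSS-cong (λ f∈ → B⇒A (candidate-avoids (proj₁ Z-circuit) f∈))
                              (λ f∈ → A⇒B (candidate-avoids (proj₁ Z-circuit) f∈)) positive)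

support-⊖-single : support Y ⊆ T ∪ ⁅ e ⁆ → f ∈ support (Y ⊖ T) → f ≡ e
support-⊖-single Y⊆ f∈ = let f∈Y , f∉T = support-⊖⁻ f∈ in [ ⊥-elim ∘ f∉T , (λ f≡e → f≡e) ]′ (x∈p∪⁅y⁆⁻ (Y⊆ f∈Y))

singleton-contract : C Y → e ∈ support Y → e ∉ T → support Y ⊆ T ∪ ⁅ e ⁆ → Contract C T (Y ⊖ T)
singleton-contract {Y = Y} {T = T} cY e∈ e∉T Y⊆ = candidate cY (λ Y⊆T → e∉T (Y⊆T e∈)) , minimal
  where
  minimal : ∀ W → ContrCand _ T W → support W ⊆ support (Y ⊖ T) → support (Y ⊖ T) ⊆ support W
  minimal W cW W⊆ f∈ = let w , w∈ = candidate-nonempty cW in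
    subst (_∈ support W) (trans (support-⊖-single Y⊆ (W⊆ w∈)) (sym (support-⊖-single Y⊆ f∈))) w∈

contract-loop : ∀ {M : OrientedMatroid m} → Delete (𝒞 M) S Y → e ∈ support Y → e ∉ T → support Y ⊆ T ∪ ⁅ e ⁆ →
                ¬ Acyclic (Reorient A (Contract (Delete (𝒞 M) S) T))
contract-loop {S = S} {Y = Y} {T = T} {M = M} (cY , Y⊆∁S) e∈ e∉T Y⊆ acyclic =
  [ acyclic _ (_ , Y-loop , refl) , acyclic _ (_ , opp-Y-loop , refl) ]′
    (Positive-loop (support-⊖-single Y⊆) (candidate-signed {M = M} (proj₁ Y-loop)))
  where
  Y-loop : Contract (Delete (𝒞 M) S) T (Y ⊖ T)
  Y-loop = singleton-contract {C = Delete (𝒞 M) S} (cY , Y⊆∁S) e∈ e∉T Y⊆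
  opp-Y-loop : Contract (Delete (𝒞 M) S) T (opp Y ⊖ T)
  opp-Y-loop = singleton-contract {C = Delete (𝒞 M) S} (C1 M Y cY , λ f∈ → Y⊆∁S (support-opp f∈))
                                   (support-opp e∈) e∉T (λ f∈ → Y⊆ (support-opp f∈))

Independent : OrientedMatroid m → Subset m → Set
Independent M I = ∀ X → 𝒞 M X → support X ⊈ I

module _ {M : OrientedMatroid m} {S N : Subset m} {j : Fin m}
         (independent : Independent M (N ∪ ⁅ j ⁆))
         {Z : SignedSet m} (Z-circuit : Contract (Delete (𝒞 M) S) (N ∪ ⁅ j ⁆) Z) where

  private
    F : Family m
    F = Delete (𝒞 M) S

  -- Eliminating g would produce a circuit whose contraction is a candidate strictly inside Z.
  no-elimination-within : F X → F Y → X ≢ opp Y → g ∈ pos X → g ∈ neg Y → g ∈ support Z →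
                          support (X ⊖ (N ∪ ⁅ j ⁆)) ⊆ support Z → support (Y ⊖ (N ∪ ⁅ j ⁆)) ⊆ support Z → ⊥
  no-elimination-within {X = X} {Y} {g} (cX , X⊆∁S) (cY , Y⊆∁S) X≢-Y g∈pos g∈neg g∈Z X⊆Z Y⊆Z
    with C3 M X Y g cX cY X≢-Y g∈pos g∈neg
  ... | W , cW , pos⊆ , neg⊆ = g∉W (proj₁ (support-⊖⁻ (Z⊆W g∈Z)))
    where
    from-X∪Y : ∀ {f} → f ∈ support W → (f ∈ support X ⊎ f ∈ support Y) × f ≢ g
    from-X∪Y {f} f∈ with x∈p∪q⁻ (pos W) (neg W) f∈
    ... | inj₁ f∈pos = let f∈X∪Y , f≢g = x∈p-y⁻ (pos⊆ f∈pos) in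
      map-⊎ (λ h → x∈p∪q⁺ (inj₁ h)) (λ h → x∈p∪q⁺ (inj₁ h)) (x∈p∪q⁻ (pos X) (pos Y) f∈X∪Y) , f≢g
    ... | inj₂ f∈neg = let f∈X∪Y , f≢g = x∈p-y⁻ (neg⊆ f∈neg) in
      map-⊎ (λ h → x∈p∪q⁺ (inj₂ h)) (λ h → x∈p∪q⁺ (inj₂ h)) (x∈p∪q⁻ (neg X) (neg Y) f∈X∪Y) , f≢g
    FW : F W
    FW = cW , λ f∈ → [ X⊆∁S , Y⊆∁S ]′ (proj₁ (from-X∪Y f∈))
    W⊆Z : support (W ⊖ (N ∪ ⁅ j ⁆)) ⊆ support Z
    W⊆Z f∈ = let f∈W , f∉NJ = support-⊖⁻ f∈ in
      [ (λ f∈X → X⊆Z (support-⊖⁺ f∈X f∉NJ)) , (λ f∈Y → Y⊆Z (support-⊖⁺ f∈Y f∉NJ)) ]′ (proj₁ (from-X∪Y f∈W))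
    Z⊆W : support Z ⊆ support (W ⊖ (N ∪ ⁅ j ⁆))
    Z⊆W = proj₂ Z-circuit _ (candidate FW (independent W cW)) W⊆Z
    g∉W : g ∉ support W
    g∉W g∈ = proj₂ (from-X∪Y g∈) refl

  conforming-shrink : ContrCand F N V → V ⊖ ⁅ j ⁆ ≼ Z → ContrCand F N W →
                      support W ⊆ support V → support V ⊈ support W → W ⊖ ⁅ j ⁆ ≼ Z
  conforming-shrink {V = V} {W} (Y₁ , FY₁ , _ , refl) (pos-conf , neg-conf) (Y₂ , FY₂ , _ , refl) W⊆V V⊈W =
    pos⊆ , neg⊆
    where
    V⊆Z : support (V ⊖ ⁅ j ⁆) ⊆ support Z
    V⊆Z = ≼⇒support⊆ (pos-conf , neg-conf)
    Y₁⊆Z : support (Y₁ ⊖ (N ∪ ⁅ j ⁆)) ⊆ support Z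
    Y₁⊆Z = subst (λ X → support X ⊆ support Z) ⊖-⊖ V⊆Z
    Y₂⊆Z : support (Y₂ ⊖ (N ∪ ⁅ j ⁆)) ⊆ support Z
    Y₂⊆Z = subst (λ X → support X ⊆ support Z) ⊖-⊖ (λ f∈ → V⊆Z (support-⊖-mono W⊆V f∈))
    Y₂≢-Y₁ : Y₂ ≢ opp Y₁
    Y₂≢-Y₁ refl = V⊈W support-opp
    Y₁≢-Y₂ : Y₁ ≢ opp Y₂
    Y₁≢-Y₂ refl = Y₂≢-Y₁ refl
    pos⊆ : pos (W ⊖ ⁅ j ⁆) ⊆ pos Z
    pos⊆ {g} g∈ with g ∈? pos Z
    ... | yes g∈posZ = g∈posZ
    ... | no g∉posZ with x∈p-y⁻ g∈
    ...   | g∈posW , g≢j with x∈p∪q⁻ (pos V) (neg V) (W⊆V (x∈p∪q⁺ (inj₁ g∈posW)))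
    ...     | inj₁ g∈posV = ⊥-elim (g∉posZ (pos-conf (x∈p∧x≢y⇒x∈p-y g∈posV g≢j)))
    ...     | inj₂ g∈negV = ⊥-elim (no-elimination-within FY₂ FY₁ Y₂≢-Y₁
                              (proj₁ (x∈p─q⁻ g∈posW)) (proj₁ (x∈p─q⁻ g∈negV))
                              (V⊆Z (x∈p∪q⁺ (inj₂ (x∈p∧x≢y⇒x∈p-y g∈negV g≢j)))) Y₂⊆Z Y₁⊆Z)
    neg⊆ : neg (W ⊖ ⁅ j ⁆) ⊆ neg Z
    neg⊆ {g} g∈ with g ∈? neg Z
    ... | yes g∈negZ = g∈negZ
    ... | no g∉negZ with x∈p-y⁻ g∈
    ...   | g∈negW , g≢j with x∈p∪q⁻ (pos V) (neg V) (W⊆V (x∈p∪q⁺ (inj₂ g∈negW)))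
    ...     | inj₂ g∈negV = ⊥-elim (g∉negZ (neg-conf (x∈p∧x≢y⇒x∈p-y g∈negV g≢j)))
    ...     | inj₁ g∈posV = ⊥-elim (no-elimination-within FY₁ FY₂ Y₁≢-Y₂
                              (proj₁ (x∈p─q⁻ g∈posV)) (proj₁ (x∈p─q⁻ g∈negW))
                              (V⊆Z (x∈p∪q⁺ (inj₁ (x∈p∧x≢y⇒x∈p-y g∈posV g≢j)))) Y₁⊆Z Y₂⊆Z)

  -- Minimality of a candidate cannot be decided (candidates are not enumerable), so the
  -- circuit of M / N is only obtained up to double negation.
  lift-from : ∀ V → Acc _<_ ∣ support V ∣ → ContrCand F N V → V ⊖ ⁅ j ⁆ ≼ Z →
              ¬ ¬ (∃ λ V′ → Contract F N V′ × V′ ⊖ ⁅ j ⁆ ≼ Z)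
  lift-from V (acc smaller) cV V≼Z no-lift = no-lift (V , (cV , minimal) , V≼Z)
    where
    minimal : ∀ W → ContrCand F N W → support W ⊆ support V → support V ⊆ support W
    minimal W cW W⊆V with support V ⊆? support W
    ... | yes V⊆W = V⊆W
    ... | no V⊈W = ⊥-elim (lift-from W (smaller (p⊂q⇒∣p∣<∣q∣ (W⊆V , ⊈⇒∃∉ V⊈W))) cW
                                      (conforming-shrink cV V≼Z cW W⊆V V⊈W) no-lift)

  contract-lift : ¬ ¬ (∃ λ V → Contract F N V × V ⊖ ⁅ j ⁆ ≼ Z)
  contract-lift =
    let (Y , FY , _ , Z≡Y⊖NJ) , _ = Z-circuit
        Y⊈N : support Y ⊈ N
        Y⊈N Y⊆N = independent Y (proj₁ FY) λ f∈ → x∈p∪q⁺ (inj₁ (Y⊆N f∈))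
    in lift-from (Y ⊖ N) (<-wellFounded _) (candidate FY Y⊈N)
                 (subst (Y ⊖ N ⊖ ⁅ j ⁆ ≼_) (trans ⊖-⊖ (sym Z≡Y⊖NJ)) ≼-refl)

acyclic-contract : ∀ {M : OrientedMatroid m} → Independent M (N ∪ ⁅ j ⁆) → j ∉ A →
                   Acyclic (Reorient A (Contract (Delete (𝒞 M) S) N)) →
                   Acyclic (Reorient ⁅ j ⁆ (Reorient A (Contract (Delete (𝒞 M) S) N))) →
                   Acyclic (Reorient A (Contract (Delete (𝒞 M) S) (N ∪ ⁅ j ⁆)))
acyclic-contract {N = N} {j = j} {S = S} {M = M} independent j∉A acyclic acyclic-j _ (Z , Z-circuit , refl) positive =
  contract-lift {M = M} {S} {N} {j} independent Z-circuit λ (V , V-circuit , V≼Z) →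
    [ acyclic _ (V , V-circuit , refl) , acyclic-j _ (_ , (V , V-circuit , refl) , refl) ]′
      (Positive-reorientSS-extend V≼Z (candidate-signed {M = M} (proj₁ V-circuit)) j∉A positive)

NBC⇒independent-∪ : ∀ {M : OrientedMatroid m} → NBC M N → (∀ {f} → f ∈ N → toℕ f < toℕ j) →
                    Independent M (N ∪ ⁅ j ⁆)
NBC⇒independent-∪ {N = N} {j} {M} nbc N<j X cX X⊆N∪j =
  let e , e∈X , e-max = max-element (support X) (≢∅⇒Nonempty (C0 M X cX)) in
  nbc _ (X , cX , e , e∈X , e-max , refl) (rest⊆N e∈X e-max)
  where
  rest⊆N : ∀ {e} → e ∈ support X → (∀ f → f ∈ support X → toℕ f ≤ toℕ e) → support X - e ⊆ N
  rest⊆N e∈X e-max f∈ with x∈p-y⁻ f∈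
  ... | f∈X , f≢e with x∈p∪⁅y⁆⁻ (X⊆N∪j f∈X)
  ...   | inj₁ f∈N = f∈N
  ...   | inj₂ refl with x∈p∪⁅y⁆⁻ (X⊆N∪j e∈X)
  ...     | inj₁ e∈N = ⊥-elim (<⇒≱ (N<j e∈N) (e-max _ f∈X))
  ...     | inj₂ refl = ⊥-elim (f≢e refl)

NBC-∪ : ∀ {M : OrientedMatroid m} → NBC M N → (∀ {f} → f ∈ N → toℕ f < toℕ j) →
        (∀ X e → 𝒞 M X → e ∈ support X → toℕ j < toℕ e → support X ⊆ (N ∪ ⁅ j ⁆) ∪ ⁅ e ⁆ → ⊥) →
        NBC M (N ∪ ⁅ j ⁆)
NBC-∪ {N = N} {j} nbc N<j no-loop B (X , cX , e , e∈X , e-max , refl) B⊆N∪j with j ∈? (support X - e)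
... | no j∉B = nbc _ (X , cX , e , e∈X , e-max , refl) λ f∈B →
  [ (λ f∈N → f∈N) , (λ { refl → ⊥-elim (j∉B f∈B) }) ]′ (x∈p∪⁅y⁆⁻ (B⊆N∪j f∈B))
... | yes j∈B = no-loop X e cX e∈X j<e X⊆
  where
  j<e : toℕ j < toℕ e
  j<e = let j∈X , j≢e = x∈p-y⁻ j∈B in ≤∧≢⇒< (e-max j j∈X) (j≢e ∘ toℕ-injective)
  X⊆ : support X ⊆ (N ∪ ⁅ j ⁆) ∪ ⁅ e ⁆
  X⊆ {f} f∈ with f ≟ᶠ e
  ... | yes refl = y∈p∪⁅y⁆ _ e
  ... | no f≢e = x∈p∪q⁺ (inj₁ (B⊆N∪j (x∈p∧x≢y⇒x∈p-y f∈ f≢e)))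

module _ {M : OrientedMatroid m} {j : Fin m} {N A : Subset m} where

  InN-suc-delete : InN M (toℕ j) (N , A) → j ∉ A → InN M (suc (toℕ j)) (N , A)
  InN-suc-delete (N⊆Ek , A⊆∁Ek , nbc , acyclic) j∉A =
    (λ f∈ → Ek⊆Ek-suc (N⊆Ek f∈)) , ∁Ek-suc A⊆∁Ek j∉A , nbc ,
    acyclic-delete Ek⊆Ek-suc (λ _ f∈ → f∈) (λ _ f∈ → f∈) acyclic

  InN-suc-unreorient : InN M (toℕ j) (N , A) → j ∈ A → InN M (suc (toℕ j)) (N , A - j)
  InN-suc-unreorient (N⊆Ek , A⊆∁Ek , nbc , acyclic) j∈A =
    (λ f∈ → Ek⊆Ek-suc (N⊆Ek f∈)) , ∁Ek-suc (λ f∈ → A⊆∁Ek (p─q⊆p A ⁅ j ⁆ f∈)) j∉A-j , nbc ,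
    acyclic-delete Ek⊆Ek-suc (λ f∉ f∈A → x∈p∧x≢y⇒x∈p-y f∈A λ { refl → f∉ j∈Ek-suc─N })
                             (λ _ f∈ → p─q⊆p A ⁅ j ⁆ f∈) acyclic
    where
    j∉A-j : j ∉ A - j
    j∉A-j j∈ = proj₂ (x∈p-y⁻ j∈) refl
    j∈Ek-suc─N : j ∈ Ek (suc (toℕ j)) ─ N
    j∈Ek-suc─N = x∈p∧x∉q⇒x∈p─q j∈Ek-suc (λ j∈N → j∉Ek (N⊆Ek j∈N))

  InN-suc-contract : InN M (toℕ j) (N , A) → j ∉ A → Acyclic (Reorient ⁅ j ⁆ (Mk M (toℕ j) N A)) →
                     InN M (suc (toℕ j)) (N ∪ ⁅ j ⁆ , A)
  InN-suc-contract (N⊆Ek , A⊆∁Ek , nbc , acyclic) j∉A acyclic-j =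
    N∪j⊆Ek-suc , ∁Ek-suc A⊆∁Ek j∉A , NBC-∪ {M = M} nbc N<j no-loop , acyclic′
    where
    N<j : ∀ {f} → f ∈ N → toℕ f < toℕ j
    N<j f∈N = ∈Ek⇒toℕ< (N⊆Ek f∈N)
    N∪j⊆Ek-suc : N ∪ ⁅ j ⁆ ⊆ Ek (suc (toℕ j))
    N∪j⊆Ek-suc f∈ = [ (λ f∈N → Ek⊆Ek-suc (N⊆Ek f∈N)) , (λ { refl → j∈Ek-suc }) ]′ (x∈p∪⁅y⁆⁻ f∈)
    acyclic′ : Acyclic (Mk M (suc (toℕ j)) (N ∪ ⁅ j ⁆) A)
    acyclic′ = subst (λ D → Acyclic (Reorient A (Contract (Delete (𝒞 M) D) (N ∪ ⁅ j ⁆)))) (sym Ek-suc─∪)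
                     (acyclic-contract {M = M} (NBC⇒independent-∪ {M = M} nbc N<j) j∉A acyclic acyclic-j)
    no-loop : ∀ X e → 𝒞 M X → e ∈ support X → toℕ j < toℕ e → support X ⊆ (N ∪ ⁅ j ⁆) ∪ ⁅ e ⁆ → ⊥
    no-loop X e cX e∈X j<e X⊆ = contract-loop {M = M} (cX , X-deleted) e∈X e∉N∪j X⊆ acyclic′
      where
      e∉N∪j : e ∉ N ∪ ⁅ j ⁆
      e∉N∪j = x∉p∪⁅y⁆ (λ e∈N → <⇒≱ (N<j e∈N) (<⇒≤ j<e)) (λ { refl → <-irrefl refl j<e })
      X-deleted : support X ⊆ ∁ (Ek (suc (toℕ j)) ─ (N ∪ ⁅ j ⁆))
      X-deleted f∈ = x∉p⇒x∈∁p λ f∈Ek─N∪j → let f∈Ek , f∉N∪j = x∈p─q⁻ f∈Ek─N∪j in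
        [ f∉N∪j , (λ { refl → <⇒≱ j<e (≤-pred (∈Ek⇒toℕ< f∈Ek)) }) ]′ (x∈p∪⁅y⁆⁻ (X⊆ f∈))

lemma2p3 : (m : ℕ) (M : OrientedMatroid m) → Loopless M →
    (j : Fin m) (N A : Subset m) → InN M (toℕ j) (N , A) →
    (d : Dec (Acyclic (Reorient ⁅ j ⁆ (Mk M (toℕ j) N A)))) →
    InN M (suc (toℕ j)) (ψ M j N A d)
lemma2p3 m M _ j N A N,A∈𝒩 d with lookup A j in A[j]
... | true = InN-suc-unreorient {M = M} {j} N,A∈𝒩 (lookup⇒[]= j A A[j])
... | false with d
...   | yes acyclic-j = InN-suc-contract {M = M} {j} N,A∈𝒩 (lookup≡false⇒∉ A[j]) acyclic-j
...   | no _ = InN-suc-delete {M = M} {j} N,A∈𝒩 (lookup≡false⇒∉ A[j])
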